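{- Let $\Psi$ be a weighted directed graph with finite vertex set ${\tt N}$, let $\aleph$ be a partition of ${\tt N}$ by which $\Psi$ is tree-divisible, and let $F'\in{\cal F}^k(\Psi|\aleph)$. Then $F'$ has at least one principal $F\in{\cal F}^k(\Psi)$.
   Context: An entering forest is a directed graph in which at most one arc leaves each vertex and there are no directed cycles; its components are entering trees, whose root is the unique vertex with no outgoing arc. ${\cal F}^k(G)$ denotes the set of spanning entering forests of a directed graph $G$ consisting of exactly $k$ trees. $G|_{\tt D}$ is the subgraph of $G$ induced by ${\tt D}$. For a directed graph $G$ with vertex set ${\tt N}$ (a spanning subgraph of $\Psi$) and ${\tt D}\subseteq{\tt N}$: ${\cal T}^\bullet_{\tt D}(G)$ is the set of entering trees that are subgraphs of $G$ with vertex set ${\tt D}$; ${\cal T}^\circ_{\tt D}(G)$ is the set of entering trees $T\subseteq G$ with ${\tt D}\subset{\tt V}T$, $|{\tt V}T|=|{\tt D}|+1$ and $T|_{\tt D}\in{\cal T}^\bullet_{\tt D}(G)$. For distinct ${\tt X},{\tt Y}\in\aleph$, ${\cal T}_{\tt XY}(G)$ is the set of $T\in{\cal T}^\circ_{\tt X}(G)$ whose root lies in ${\tt Y}$. $G$ is tree-divisible by $\aleph$ if ${\cal T}^\bullet_{\tt X}(G)\ne\emptyset$ for all ${\tt X}\in\aleph$. The splitting $G|\aleph=G^\aleph$ of a tree-divisible $G$ is the directed graph with vertex set $\aleph$ having an arc $({\tt X},{\tt Y})$, ${\tt X}\ne{\tt Y}$, iff ${\cal T}_{\tt XY}(G)\ne\emptyset$.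 For a tree-divisible $F\in{\cal F}^k(\Psi)$, a spanning entering forest $F'$ of $\Psi|\aleph$ is a representative of $F$, and $F$ is a principal of $F'$, if the arc set of $F'$ equals the arc set of $F^\aleph$. -}

module Defs where

open import Data.Nat using (ℕ; zero; suc; _+_)
open import Data.Bool using (Bool; true; false; _∧_; _∨_; if_then_else_)
open import Data.Fin using (Fin; zero; suc; _≟_)
open import Data.Product using (Σ; ∃; _×_; _,_)
open import Relation.Nullary using (¬_)
open import Relation.Nullary.Decidable using (⌊_⌋)
open import Relation.Binary.PropositionalEquality using (_≡_)

-- Vertex set N = Fin n.  A (sub)set of vertices is a Boolean predicate.
VSet : ℕ → Set
VSet n = Fin n → Bool

-- A directed graph on Fin n, given by its arc set (weights are irrelevant here).
Graph : ℕ → Set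
Graph n = Fin n → Fin n → Bool

-- A (possibly undecided) arc relation, used for the splitting graph Ψ|ℵ.
ArcRel : ℕ → Set₁
ArcRel n = Fin n → Fin n → Set

arcsOf : ∀ {n} → Graph n → ArcRel n
arcsOf G u v = G u v ≡ true

count : ∀ {n} → (Fin n → Bool) → ℕ
count {zero}  f = 0
count {suc n} f = (if f zero then 1 else 0) + count (λ i → f (suc i))

anyᵇ : ∀ {n} → (Fin n → Bool) → Bool
anyᵇ {zero}  f = false
anyᵇ {suc n} f = f zero ∨ anyᵇ (λ i → f (suc i))

_⊆ᴬ_ : ∀ {n} → Graph n → ArcRel n → Set
H ⊆ᴬ R = ∀ u v → H u v ≡ true → R u v

hasOut : ∀ {n} → Graph n → Fin n → Bool
hasOut A v = anyᵇ (A v)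

IsRoot : ∀ {n} → Graph n → Fin n → Set
IsRoot A v = hasOut A v ≡ false

OutAtMostOne : ∀ {n} → Graph n → Set
OutAtMostOne A = ∀ u v w → A u v ≡ true → A u w ≡ true → v ≡ w

data Path {n} (A : Graph n) : Fin n → Fin n → Set where
  one  : ∀ {u v} → A u v ≡ true → Path A u v
  _∷_  : ∀ {u v w} → A u v ≡ true → Path A v w → Path A u w

Acyclic : ∀ {n} → Graph n → Set
Acyclic A = ∀ v → ¬ Path A v v

IsEnteringForest : ∀ {n} → Graph n → Set
IsEnteringForest A = OutAtMostOne A × Acyclic A

-- number of trees of a spanning entering forest = number of roots
numTrees : ∀ {n} → Graph n → ℕ
numTrees A = count (λ v → if hasOut A v then false else true)

-- F ∈ 𝓕ᵏ(G): spanning entering forest of G with exactly k trees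
SpanningForest : ∀ {n} → ArcRel n → ℕ → Graph n → Set
SpanningForest G k F = (F ⊆ᴬ G) × IsEnteringForest F × numTrees F ≡ k

ArcsWithin : ∀ {n} → VSet n → Graph n → Set
ArcsWithin V A = ∀ u v → A u v ≡ true → (V u ≡ true) × (V v ≡ true)

-- (V, A) is an entering tree rooted at r: an entering forest with vertex set V
-- having exactly one root (i.e. exactly one component), namely r
IsEnteringTreeAt : ∀ {n} → VSet n → Graph n → Fin n → Set
IsEnteringTreeAt V A r =
  ArcsWithin V A × IsEnteringForest A ×
  (V r ≡ true) × IsRoot A r ×
  (∀ v → V v ≡ true → IsRoot A v → v ≡ r)

IsEnteringTree : ∀ {n} → VSet n → Graph n → Set
IsEnteringTree V A = ∃ λ r → IsEnteringTreeAt V A r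

restrict : ∀ {n} → Graph n → VSet n → Graph n
restrict A D u v = A u v ∧ D u ∧ D v

-- A ∈ 𝒯•_D(G): entering tree which is a subgraph of G with vertex set D
TreeBullet : ∀ {n} → Graph n → VSet n → Graph n → Set
TreeBullet G D A = (A ⊆ᴬ arcsOf G) × IsEnteringTree D A

TreeCirc : ∀ {n} → Graph n → VSet n → VSet n → Graph n → Set
TreeCirc G D V A =
  (A ⊆ᴬ arcsOf G) × IsEnteringTree V A ×
  (∀ v → D v ≡ true → V v ≡ true) × count V ≡ suc (count D) ×
  TreeBullet G D (restrict A D)

-- A partition ℵ of Fin n into m blocks, given by the block map blk
-- (blk v = the block containing v); all blocks are nonempty.
IsPartition : ∀ {n m} → (Fin n → Fin m) → Set
IsPartition {n} {m} blk = ∀ (X : Fin m) → ∃ λ (v : Fin n) → blk v ≡ X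

block : ∀ {n m} → (Fin n → Fin m) → Fin m → VSet n
block blk X v = ⌊ blk v ≟ X ⌋

TreeDivisible : ∀ {n m} → Graph n → (Fin n → Fin m) → Set
TreeDivisible G blk = ∀ X → ∃ λ A → TreeBullet G (block blk X) A

TXY-nonempty : ∀ {n m} → Graph n → (Fin n → Fin m) → Fin m → Fin m → Set
TXY-nonempty G blk X Y =
  ∃ λ V → ∃ λ A → ∃ λ r →
    TreeCirc G (block blk X) V A × IsEnteringTreeAt V A r × blk r ≡ Y

-- arcs of the splitting G|ℵ = G^ℵ
SplitArc : ∀ {n m} → Graph n → (Fin n → Fin m) → ArcRel m
SplitArc G blk X Y = (¬ X ≡ Y) × TXY-nonempty G blk X Y

{-# OPTIONS --safe #-}
-- For every block X choose one tree of Ψ: a tree of 𝒯•_X(Ψ) if X is a root of F′, and a tree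
-- of 𝒯_XY(Ψ) if F′ has the arc X → Y; a counting argument shows that the only vertex of the
-- latter outside X is its root, which lies in Y.  Let every vertex use the out-arc of the tree
-- chosen for its block; this gives F.  Every arc of F leaving a block follows an arc of F′, so a
-- cycle of F would be a cycle of one tree or project to a cycle of F′, and the roots of F are
-- exactly the roots of the trees chosen for the roots of F′.  Conversely a tree of 𝒯_XY(F) has
-- to use an arc of F from X into Y, so the splitting of F is F′.
module Submission where

open import Defs
open import Data.Nat using (ℕ; zero; suc; _+_; _≤_; z≤n; s≤s)
open import Data.Nat.Properties using (≤-antisym; ≤-reflexive; ≤-trans; +-suc; 1+n≰n; module ≤-Reasoning)
open import Data.Fin using (Fin; zero; suc; _≟_)
open import Data.Fin.Properties using (suc-injective; 0≢1+n)
open import Data.Product using (∃; ∃₂; _×_; _,_; proj₁; proj₂)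
open import Data.Sum using (_⊎_; inj₁; inj₂)
open import Data.Empty using (⊥-elim)
open import Data.Bool using (Bool; true; false; not; _∧_; if_then_else_)
open import Data.Bool.Properties using (∧-conicalˡ; ∧-conicalʳ; not-¬; ¬-not)
open import Function using (_∘_)
open import Relation.Nullary using (¬_; yes; no; does)
open import Relation.Binary.PropositionalEquality using (_≡_; refl; sym; trans; cong; subst)

anyᵇ⁺ : ∀ {n} (f : Fin n → Bool) i → f i ≡ true → anyᵇ f ≡ true
anyᵇ⁺ f zero fi rewrite fi = refl
anyᵇ⁺ f (suc i) fi with f zero
... | true  = refl
... | false = anyᵇ⁺ (f ∘ suc) i fi

anyᵇ⁻ : ∀ {n} (f : Fin n → Bool) → anyᵇ f ≡ true → ∃ λ i → f i ≡ true
anyᵇ⁻ {suc n} f any with f zero in f0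
... | true  = zero , f0
... | false with anyᵇ⁻ (f ∘ suc) any
...   | i , fi = suc i , fi

isRoot⇒noArc : ∀ {n} {A : Graph n} {u v} → IsRoot A u → ¬ A u v ≡ true
isRoot⇒noArc {A = A} {u} {v} root a = not-¬ (anyᵇ⁺ (A u) v a) root

module _ {n m} (blk : Fin n → Fin m) {X : Fin m} {v : Fin n} where

  ∈block⁺ : blk v ≡ X → block blk X v ≡ true
  ∈block⁺ v∈X with blk v ≟ X
  ... | yes _ = refl
  ... | no v∉X = ⊥-elim (v∉X v∈X)

  ∈block⁻ : block blk X v ≡ true → blk v ≡ X
  ∈block⁻ v∈X with blk v ≟ X
  ... | yes v∈X′ = v∈X′

  ∉block : ¬ blk v ≡ X → block blk X v ≡ false
  ∉block v∉X with blk v ≟ X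
  ... | yes v∈X = ⊥-elim (v∉X v∈X)
  ... | no _ = refl

restrict⁺ : ∀ {n} {A : Graph n} {D : VSet n} {u v} →
  A u v ≡ true → D u ≡ true → D v ≡ true → restrict A D u v ≡ true
restrict⁺ a Du Dv rewrite a | Du | Dv = refl

erase : ∀ {n} → (Fin n → Bool) → Fin n → Fin n → Bool
erase q x y = not (does (y ≟ x)) ∧ q y

erase-keeps : ∀ {n} (q : Fin n → Bool) {x y} → ¬ y ≡ x → q y ≡ true → erase q x y ≡ true
erase-keeps q {x} {y} y≢x qy with y ≟ x
... | no _ = qy
... | yes y≡x = ⊥-elim (y≢x y≡x)

count-erase : ∀ {n} (q : Fin n → Bool) x → q x ≡ true → count q ≡ suc (count (erase q x))
count-erase {suc n} q zero qx rewrite qx = refl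
count-erase {suc n} q (suc x) qx =
  trans (cong ((if q zero then 1 else 0) +_) (count-erase (q ∘ suc) x qx)) (+-suc _ _)

count-≤-injection : ∀ {a b} (p : Fin a → Bool) (q : Fin b → Bool) (g : Fin a → Fin b) →
  (∀ i → p i ≡ true → q (g i) ≡ true) →
  (∀ i j → p i ≡ true → p j ≡ true → g i ≡ g j → i ≡ j) →
  count p ≤ count q
count-≤-injection {zero} _ _ _ _ _ = z≤n
count-≤-injection {suc a} p q g pq inj with p zero in p0
... | false = count-≤-injection (p ∘ suc) q (g ∘ suc) (pq ∘ suc)
  (λ i j pi pj eq → suc-injective (inj (suc i) (suc j) pi pj eq))
... | true = ≤-trans (s≤s rest) (≤-reflexive (sym (count-erase q (g zero) (pq zero p0))))
  where
    rest : count (p ∘ suc) ≤ count (erase q (g zero))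
    rest = count-≤-injection (p ∘ suc) (erase q (g zero)) (g ∘ suc)
      (λ i pi → erase-keeps q (λ eq → 0≢1+n (inj zero (suc i) p0 pi (sym eq))) (pq (suc i) pi))
      (λ i j pi pj eq → suc-injective (inj (suc i) (suc j) pi pj eq))

count-bijection : ∀ {a b} (p : Fin a → Bool) (q : Fin b → Bool) (g : Fin a → Fin b) (h : Fin b → Fin a) →
  (∀ i → p i ≡ true → q (g i) ≡ true) → (∀ j → q j ≡ true → p (h j) ≡ true) →
  (∀ i → p i ≡ true → h (g i) ≡ i) → (∀ j → q j ≡ true → g (h j) ≡ j) →
  count p ≡ count q
count-bijection p q g h pq qp hg gh =
  ≤-antisym (count-≤-injection p q g pq (injective h hg)) (count-≤-injection q p h qp (injective g gh))
  where
    injective : ∀ {c d} {s : Fin c → Bool} {f : Fin c → Fin d} (f⁻¹ : Fin d → Fin c) →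
      (∀ i → s i ≡ true → f⁻¹ (f i) ≡ i) → ∀ i j → s i ≡ true → s j ≡ true → f i ≡ f j → i ≡ j
    injective f⁻¹ inv i j si sj eq = trans (sym (inv i si)) (trans (cong f⁻¹ eq) (inv j sj))

count-suc⇒unique-extra : ∀ {n} (D V : Fin n → Bool) → (∀ v → D v ≡ true → V v ≡ true) →
  count V ≡ suc (count D) →
  ∀ {a b} → V a ≡ true → D a ≡ false → V b ≡ true → D b ≡ false → a ≡ b
count-suc⇒unique-extra {n} D V D⊆V |V| {a} {b} Va Da Vb Db with a ≟ b
... | yes a≡b = a≡b
... | no a≢b = ⊥-elim (1+n≰n (begin
    suc (suc (count D))               ≤⟨ s≤s (s≤s D≤V∖ab) ⟩
    suc (suc (count (erase V∖a b)))  ≡⟨ cong suc (sym (count-erase V∖a b (erase-keeps V (a≢b ∘ sym) Vb))) ⟩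
    suc (count V∖a)                   ≡⟨ sym (count-erase V a Va) ⟩
    count V                           ≡⟨ |V| ⟩
    suc (count D)                     ∎))
  where
    open ≤-Reasoning
    V∖a : Fin n → Bool
    V∖a = erase V a
    D≤V∖ab : count D ≤ count (erase V∖a b)
    D≤V∖ab = count-≤-injection D (erase V∖a b) (λ v → v)
      (λ v Dv → erase-keeps V∖a (λ { refl → not-¬ Dv Db })
                  (erase-keeps V (λ { refl → not-¬ Dv Da }) (D⊆V v Dv)))
      (λ _ _ _ _ eq → eq)

numTrees-bijection : ∀ {a b} {A : Graph a} {B : Graph b} (g : Fin a → Fin b) (h : Fin b → Fin a) →
  (∀ v → IsRoot A v → IsRoot B (g v)) → (∀ X → IsRoot B X → IsRoot A (h X)) →
  (∀ v → IsRoot A v → h (g v) ≡ v) → (∀ X → IsRoot B X → g (h X) ≡ X) →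
  numTrees A ≡ numTrees B
numTrees-bijection g h AB BA hg gh =
  count-bijection _ _ g h (λ v → counted ∘ AB v ∘ uncounted) (λ X → counted ∘ BA X ∘ uncounted)
    (λ v → hg v ∘ uncounted) (λ X → gh X ∘ uncounted)
  where
    counted : ∀ {b} → b ≡ false → (if b then false else true) ≡ true
    counted refl = refl
    uncounted : ∀ {b} → (if b then false else true) ≡ true → b ≡ false
    uncounted {false} _ = refl
    uncounted {true} ()

module CircTree {n} {G : Graph n} {D V : VSet n} {A : Graph n} {r : Fin n}
  (circ : TreeCirc G D V A) (tree : IsEnteringTreeAt V A r) (r∉D : D r ≡ false) where

  private
    arcsWithin : ArcsWithin V A
    arcsWithin = proj₁ tree
    r∈V : V r ≡ true
    r∈V = proj₁ (proj₂ (proj₂ tree))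
    r-root : IsRoot A r
    r-root = proj₁ (proj₂ (proj₂ (proj₂ tree)))
    unique-root : ∀ v → V v ≡ true → IsRoot A v → v ≡ r
    unique-root = proj₂ (proj₂ (proj₂ (proj₂ tree)))
    D⊆V : ∀ v → D v ≡ true → V v ≡ true
    D⊆V = proj₁ (proj₂ (proj₂ circ))
    |V| : count V ≡ suc (count D)
    |V| = proj₁ (proj₂ (proj₂ (proj₂ circ)))

  outside⇒root : ∀ {v} → V v ≡ true → D v ≡ false → v ≡ r
  outside⇒root Vv Dv = count-suc⇒unique-extra D V D⊆V |V| Vv Dv r∈V r∉D

  arc-target-outside⇒root : ∀ {u v} → A u v ≡ true → D v ≡ false → v ≡ r
  arc-target-outside⇒root {u} {v} a = outside⇒root (proj₂ (arcsWithin u v a))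

  arc-source-inside : ∀ {u v} → A u v ≡ true → D u ≡ true
  arc-source-inside {u} {v} a with D u in Du
  ... | true  = refl
  ... | false with outside⇒root (proj₁ (arcsWithin u v a)) Du
  ...   | refl = ⊥-elim (isRoot⇒noArc {A = A} r-root a)

  inside⇒hasOut : ∀ {u} → D u ≡ true → hasOut A u ≡ true
  inside⇒hasOut {u} Du = ¬-not λ u-root →
    not-¬ (subst (λ z → D z ≡ true) (unique-root u (D⊆V u Du) u-root) Du) r∉D

  -- The root x of the restriction to D is no root of A, so its out-arc must leave D.
  exit-arc : ∃₂ λ u w → A u w ≡ true × D u ≡ true × w ≡ r
  exit-arc with proj₂ (proj₂ (proj₂ (proj₂ circ)))
  ... | _ , x , _ , _ , Dx , x-root-in-D , _ with anyᵇ⁻ (A x) (inside⇒hasOut Dx)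
  ...   | w , a with D w in Dw
  ...     | true  = ⊥-elim (isRoot⇒noArc {A = restrict A D} x-root-in-D (restrict⁺ {A = A} {D} a Dx Dw))
  ...     | false = x , w , a , Dx , arc-target-outside⇒root a Dw

TreeCirc-subgraph : ∀ {n} {G G′ : Graph n} {D V : VSet n} {A : Graph n} →
  TreeCirc G D V A → A ⊆ᴬ arcsOf G′ → TreeCirc G′ D V A
TreeCirc-subgraph (_ , tree , D⊆V , |V| , (_ , treeD)) A⊆G′ =
  A⊆G′ , tree , D⊆V , |V| , ((λ u v a → A⊆G′ u v (∧-conicalˡ _ _ a)) , treeD)

TXY-nonempty⇒arc : ∀ {n m} {G : Graph n} {blk : Fin n → Fin m} {X Y} → ¬ X ≡ Y →
  TXY-nonempty G blk X Y → ∃₂ λ u w → G u w ≡ true × blk u ≡ X × blk w ≡ Y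
TXY-nonempty⇒arc {blk = blk} X≢Y (_ , _ , r , circ@(A⊆G , _) , tree , r∈Y)
  with CircTree.exit-arc circ tree (∉block blk (λ r∈X → X≢Y (trans (sym r∈X) r∈Y)))
... | u , w , a , u∈X , refl = u , w , A⊆G u w a , ∈block⁻ blk u∈X , r∈Y

blockwise : ∀ {n m} → (Fin n → Fin m) → (Fin m → Graph n) → Graph n
blockwise blk G u = G (blk u) u

CrossingArcsIn : ∀ {n m} → (Fin n → Fin m) → Graph n → Graph m → Set
CrossingArcsIn blk G H = ∀ u w → G u w ≡ true → ¬ blk u ≡ blk w → H (blk u) (blk w) ≡ true

blockwise-⊇ : ∀ {n m} {blk : Fin n → Fin m} {G : Fin m → Graph n} {X} {A : Graph n} →
  (∀ u v → A u v ≡ true → blk u ≡ X × G X u v ≡ true) → A ⊆ᴬ arcsOf (blockwise blk G)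
blockwise-⊇ A⊆GX u v a with A⊆GX u v a
... | refl , a′ = a′

module _ {n m} {blk : Fin n → Fin m} {G : Fin m → Graph n} {H : Graph m}
  (crossing : CrossingArcsIn blk (blockwise blk G) H) where

  blockwise-path : ∀ {u w} → Path (blockwise blk G) u w →
    Path H (blk u) (blk w) ⊎ (blk u ≡ blk w × Path (G (blk u)) u w)
  blockwise-path {u} {w} (one a) with blk u ≟ blk w
  ... | yes same  = inj₂ (same , one a)
  ... | no differ = inj₁ (one (crossing u w a differ))
  blockwise-path {u} {w} (_∷_ {v = v} a p) with blk u ≟ blk v | blockwise-path p
  ... | yes same  | inj₁ q          = inj₁ (subst (λ Z → Path H Z (blk w)) (sym same) q)
  ... | yes same  | inj₂ (same′ , q) = inj₂ (trans same same′ , a ∷ subst (λ Z → Path (G Z) v w) (sym same) q)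
  ... | no differ | inj₁ q          = inj₁ (crossing u v a differ ∷ q)
  ... | no differ | inj₂ (same′ , _) = inj₁ (one (subst (λ Z → H (blk u) Z ≡ true) same′ (crossing u v a differ)))

  blockwise-acyclic : Acyclic H → (∀ X → Acyclic (G X)) → Acyclic (blockwise blk G)
  blockwise-acyclic H-acyclic G-acyclic v p with blockwise-path p
  ... | inj₁ q       = H-acyclic (blk v) q
  ... | inj₂ (_ , q) = G-acyclic (blk v) v q

SplitArc-⊆ : ∀ {n m} {blk : Fin n → Fin m} {G : Graph n} {H : Graph m} →
  CrossingArcsIn blk G H → ∀ {X Y} → SplitArc G blk X Y → H X Y ≡ true
SplitArc-⊆ crossing (X≢Y , T)
  with TXY-nonempty⇒arc X≢Y T
... | u , w , a , refl , refl = crossing u w a X≢Y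

module Principal {n m} (Ψ : Graph n) (blk : Fin n → Fin m) (divisible : TreeDivisible Ψ blk)
  (F′ : Graph m) (F′⊆split : F′ ⊆ᴬ SplitArc Ψ blk) (F′-out : OutAtMostOne F′) where

  data Piece (X : Fin m) : Set where
    rootPiece : IsRoot F′ X → (A : Graph n) → TreeBullet Ψ (block blk X) A → Piece X
    arcPiece  : ∀ {Y} → F′ X Y ≡ true → SplitArc Ψ blk X Y → Piece X

  arcs : ∀ {X} → Piece X → Graph n
  arcs (rootPiece _ A _)            = A
  arcs (arcPiece _ (_ , _ , A , _)) = A

  root : ∀ {X} → Piece X → Fin n
  root (rootPiece _ _ (_ , r , _))      = r
  root (arcPiece _ (_ , _ , _ , r , _)) = r

  piece-⊆Ψ : ∀ {X} (p : Piece X) → arcs p ⊆ᴬ arcsOf Ψ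
  piece-⊆Ψ (rootPiece _ _ (A⊆Ψ , _))                     = A⊆Ψ
  piece-⊆Ψ (arcPiece _ (_ , _ , _ , _ , (A⊆Ψ , _) , _)) = A⊆Ψ

  piece-forest : ∀ {X} (p : Piece X) → IsEnteringForest (arcs p)
  piece-forest (rootPiece _ _ (_ , _ , _ , forest , _))                = forest
  piece-forest (arcPiece _ (_ , _ , _ , _ , _ , (_ , forest , _) , _)) = forest

  private
    r∉X : ∀ {X Y r} → ¬ X ≡ Y → blk r ≡ Y → block blk X r ≡ false
    r∉X X≢Y r∈Y = ∉block blk (λ r∈X → X≢Y (trans (sym r∈X) r∈Y))

  piece-crossing : ∀ {X u w} (p : Piece X) → blk u ≡ X → arcs p u w ≡ true → ¬ blk w ≡ X → F′ X (blk w) ≡ true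
  piece-crossing {u = u} {w} (rootPiece _ _ (_ , _ , arcsWithin , _)) _ a w∉X =
    ⊥-elim (w∉X (∈block⁻ blk (proj₂ (arcsWithin u w a))))
  piece-crossing (arcPiece f (X≢Y , _ , _ , _ , circ , tree , r∈Y)) _ a w∉X
    with CircTree.arc-target-outside⇒root circ tree (r∉X X≢Y r∈Y) a (∉block blk w∉X)
  ... | refl = subst (λ Z → F′ _ Z ≡ true) (sym r∈Y) f

  piece-roots : ∀ {X u} (p : Piece X) → blk u ≡ X → IsRoot (arcs p) u → IsRoot F′ X × u ≡ root p
  piece-roots {u = u} (rootPiece X-root _ (_ , _ , _ , _ , _ , _ , unique-root)) u∈X u-root =
    X-root , unique-root u (∈block⁺ blk u∈X) u-root
  piece-roots (arcPiece _ (X≢Y , _ , _ , _ , circ , tree , r∈Y)) u∈X u-root =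
    ⊥-elim (not-¬ (CircTree.inside⇒hasOut circ tree (r∉X X≢Y r∈Y) (∈block⁺ blk u∈X)) u-root)

  piece-root : ∀ {X} (p : Piece X) → IsRoot F′ X → blk (root p) ≡ X × IsRoot (arcs p) (root p)
  piece-root (rootPiece _ _ (_ , _ , _ , _ , r∈X , r-root , _)) _ = ∈block⁻ blk r∈X , r-root
  piece-root (arcPiece f _) X-root = ⊥-elim (isRoot⇒noArc {A = F′} X-root f)

  piece-spans : ∀ {X} (p : Piece X) →
    ∃ λ A → (∀ u v → A u v ≡ true → blk u ≡ X × arcs p u v ≡ true) × IsEnteringTree (block blk X) A
  piece-spans (rootPiece _ A (_ , tree@(_ , arcsWithin , _))) =
    A , (λ u v a → ∈block⁻ blk (proj₁ (arcsWithin u v a)) , a) , tree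
  piece-spans {X} (arcPiece _ (_ , _ , A , _ , (_ , _ , _ , _ , (_ , treeX)) , _)) =
    restrict A (block blk X) ,
    (λ u v a → ∈block⁻ blk (∧-conicalˡ _ (block blk X v) (∧-conicalʳ (A u v) _ a)) , ∧-conicalˡ _ _ a) ,
    treeX

  piece-TXY : ∀ {X Y} (p : Piece X) → F′ X Y ≡ true →
    ∃₂ λ V r → (∀ u v → arcs p u v ≡ true → blk u ≡ X) ×
      TreeCirc Ψ (block blk X) V (arcs p) × IsEnteringTreeAt V (arcs p) r × blk r ≡ Y
  piece-TXY (rootPiece X-root _ _) f = ⊥-elim (isRoot⇒noArc {A = F′} X-root f)
  piece-TXY {X} (arcPiece f′ (X≢Y , V , A , r , circ , tree , r∈Y′)) f =
    V , r , (λ u v a → ∈block⁻ blk (CircTree.arc-source-inside circ tree (r∉X X≢Y r∈Y′) a)) ,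
    circ , tree , trans r∈Y′ (F′-out X _ _ f′ f)

  pick : ∀ X → Piece X
  pick X with hasOut F′ X in out
  ... | false = rootPiece out (proj₁ (divisible X)) (proj₂ (divisible X))
  ... | true with anyᵇ⁻ (F′ X) out
  ...   | Y , f = arcPiece f (F′⊆split X Y f)

  F : Graph n
  F = blockwise blk (arcs ∘ pick)

  F-crossing : CrossingArcsIn blk F F′
  F-crossing u w a u≁w = piece-crossing (pick (blk u)) refl a (u≁w ∘ sym)

  F-numTrees : numTrees F ≡ numTrees F′
  F-numTrees = numTrees-bijection blk (root ∘ pick)
    (λ v v-root → proj₁ (piece-roots (pick (blk v)) refl v-root))
    (λ X X-root → let r∈X , r-root = piece-root (pick X) X-root in
                  subst (λ Z → IsRoot (arcs (pick Z)) (root (pick X))) (sym r∈X) r-root)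
    (λ v v-root → sym (proj₂ (piece-roots (pick (blk v)) refl v-root)))
    (λ X X-root → proj₁ (piece-root (pick X) X-root))

  F-divisible : TreeDivisible F blk
  F-divisible X = let A , A⊆ , tree = piece-spans (pick X) in A , blockwise-⊇ A⊆ , tree

  F-split⁺ : ∀ {X Y} → F′ X Y ≡ true → SplitArc F blk X Y
  F-split⁺ {X} {Y} f = let V , r , from-X , circ , tree , r∈Y = piece-TXY (pick X) f in
    proj₁ (F′⊆split X Y f) , V , arcs (pick X) , r ,
    TreeCirc-subgraph circ (blockwise-⊇ (λ u v a → from-X u v a , a)) , tree , r∈Y

proposition5 : ∀ {n m : ℕ} (k : ℕ) (Ψ : Graph n) (blk : Fin n → Fin m) →
    IsPartition blk → TreeDivisible Ψ blk →
    (F′ : Graph m) → SpanningForest (SplitArc Ψ blk) k F′ →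
    ∃ λ (F : Graph n) →
    SpanningForest (arcsOf Ψ) k F × TreeDivisible F blk ×
    (∀ X Y → (F′ X Y ≡ true → SplitArc F blk X Y) × (SplitArc F blk X Y → F′ X Y ≡ true))
proposition5 k Ψ blk _ divisible F′ (F′⊆split , (F′-out , F′-acyclic) , F′-trees) =
  F , (F⊆Ψ , (F-out , F-acyclic) , trans F-numTrees F′-trees) , F-divisible ,
  λ X Y → F-split⁺ , SplitArc-⊆ F-crossing
  where
    open Principal Ψ blk divisible F′ F′⊆split F′-out
    F⊆Ψ : F ⊆ᴬ arcsOf Ψ
    F⊆Ψ u = piece-⊆Ψ (pick (blk u)) u
    F-out : OutAtMostOne F
    F-out u = proj₁ (piece-forest (pick (blk u))) u
    F-acyclic : Acyclic F
    F-acyclic = blockwise-acyclic F-crossing F′-acyclic (proj₂ ∘ piece-forest ∘ pick)
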